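{- Let $n\ge1$, $N=2^n$, $k\ge1$ and $Q>0$. Suppose that $\theta=\frac{r_1}{2^{i_1}}+\dots+\frac{r_k}{2^{i_k}}$ where $i_1<\dots<i_k\le n$ are integers and $r_1,\dots,r_k$ are integers with $|r_j|\le Q$ for all $j$. Suppose furthermore that there is a positive integer $q\le Q$ and an integer $a$ coprime to $q$ such that $|\theta-a/q|\le Q/N$, and that $2^{n/2k}>4Q^2$. Then $q$ is a power of two.
   Formalization: The parameter Q ranges over the positive rationals. -}

module Defs where

open import Data.Nat as ℕ using (ℕ; zero; suc)
open import Data.Nat.Properties using (m^n≢0)
open import Data.Integer as ℤ using (ℤ; +_; -[1+_])
open import Data.Rational using (ℚ; _/_; _+_; _*_; 0ℚ)
open import Data.Fin using (Fin; zero; suc)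

pow2 : ℕ → ℕ
pow2 m = 2 ℕ.^ m

r/2^ : ℤ → ℤ → ℚ
r/2^ r (+ m)    = (r / pow2 m) {{m^n≢0 2 m}}
r/2^ r -[1+ m ] = (r ℤ.* + pow2 (suc m)) / 1

sumℚ : (k : ℕ) → (Fin k → ℚ) → ℚ
sumℚ zero    f = 0ℚ
sumℚ (suc k) f = f zero + sumℚ k (λ j → f (suc j))

_^ℚ_ : ℚ → ℕ → ℚ
p ^ℚ zero  = Data.Rational.1ℚ
p ^ℚ suc m = p * (p ^ℚ m)

ℤ→ℚ : ℤ → ℚ
ℤ→ℚ z = z / 1

-- 1 / 2^n  (so that Q * inv2^ n = Q / N with N = 2^n)
inv2^ : ℕ → ℚ
inv2^ n = (+ 1 / pow2 n) {{m^n≢0 2 n}}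

module Submission where

-- Suppose q is not a power of
-- two.  Then q divides no power of two, and coprimality of a and q forces
-- every dyadic number b/2^s to stay at distance at least 1/(2^s q) from a/q
-- ("separation").  Read θ = Σ r_j/2^{i_j} from left to right: after the
-- terms with exponent ≤ i_j have been collected into one fraction b/2^{i_j},
-- the remaining terms form a tail of size at most 2Q/2^{i_{j+1}} (geometric
-- series bound), so the hypothesis |θ - a/q| ≤ Q/N and separation give
-- 2^{i_{j+1} - i_j} ≤ 4Q² ("one gap step").  Terms with negative exponent are
-- integers and are simply absorbed.  Multiplying the gap steps along the whole
-- chain 0 ≤ i_1 < … < i_k ≤ n ("descent") gives N = 2^n ≤ (4Q²)^{k+1}, which
-- contradicts N > (4Q²)^{2k}.

open import Defs
open import Data.Nat as ℕ using (ℕ; NonZero; zero; suc)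
import Data.Nat.Properties as ℕP
open import Data.Nat.Divisibility using (_∣_; _∣?_; divides; ∣-refl; ∣-trans; ∣1⇒≡1; ∣⇒≤; 0∣⇒≡0; *-cancelˡ-∣)
open import Data.Nat.Coprimality as Coprimality using (Coprime; coprime-divisor)
open import Data.Integer as ℤ using (ℤ; +_; -[1+_])
import Data.Integer.Properties as ℤP
open import Data.Rational using (ℚ; _/_; _-_; _+_; _*_; _≤_; _<_; ∣_∣; 0ℚ; 1ℚ; -_; nonNegative; fromℚᵘ)
open import Data.Rational.Properties
import Data.Rational.Unnormalised as ℚᵘ
import Data.Rational.Unnormalised.Properties as ℚᵘP
open import Data.Rational.Solver using (module +-*-Solver)
open +-*-Solver using (solve; _:+_; _:*_; _:-_; _:=_; con)
open import Data.Fin as Fin using (Fin)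
open import Data.Empty using (⊥-elim; ⊥-elim-irr)
open import Relation.Nullary using (¬_; yes; no)
open import Relation.Binary.PropositionalEquality using (_≡_; _≢_; refl; sym; trans; cong; cong₂; subst; module ≡-Reasoning)
open import Data.Product using (∃; _×_; _,_; proj₁; proj₂)
open import Data.Sum using (_⊎_; inj₁; inj₂)

-- The embedding  ℤ→ℚ z = z / 1  is a ring and order
-- homomorphism; each fact is checked on unnormalised rationals, where it
-- holds by computation, and transported along fromℚᵘ.

fromℚᵘ-homo-+ : ∀ p r → fromℚᵘ (p ℚᵘ.+ r) ≡ fromℚᵘ p + fromℚᵘ r
fromℚᵘ-homo-+ p r = toℚᵘ-injective (ℚᵘP.≃-trans (toℚᵘ-fromℚᵘ _) (ℚᵘP.≃-sym
  (ℚᵘP.≃-trans (toℚᵘ-homo-+ (fromℚᵘ p) (fromℚᵘ r)) (ℚᵘP.+-cong (toℚᵘ-fromℚᵘ p) (toℚᵘ-fromℚᵘ r)))))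

fromℚᵘ-homo-* : ∀ p r → fromℚᵘ (p ℚᵘ.* r) ≡ fromℚᵘ p * fromℚᵘ r
fromℚᵘ-homo-* p r = toℚᵘ-injective (ℚᵘP.≃-trans (toℚᵘ-fromℚᵘ _) (ℚᵘP.≃-sym
  (ℚᵘP.≃-trans (toℚᵘ-homo-* (fromℚᵘ p) (fromℚᵘ r)) (ℚᵘP.*-cong (toℚᵘ-fromℚᵘ p) (toℚᵘ-fromℚᵘ r)))))

ℤ→ℚ-+ : ∀ x y → ℤ→ℚ (x ℤ.+ y) ≡ ℤ→ℚ x + ℤ→ℚ y
ℤ→ℚ-+ x y = trans (fromℚᵘ-cong {ℚᵘ.mkℚᵘ (x ℤ.+ y) 0} {ℚᵘ.mkℚᵘ x 0 ℚᵘ.+ ℚᵘ.mkℚᵘ y 0} (ℚᵘ.*≡* same)) (fromℚᵘ-homo-+ (ℚᵘ.mkℚᵘ x 0) (ℚᵘ.mkℚᵘ y 0))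
  where
  same : (x ℤ.+ y) ℤ.* + 1 ≡ (x ℤ.* + 1 ℤ.+ y ℤ.* + 1) ℤ.* + 1
  same rewrite ℤP.*-identityʳ x | ℤP.*-identityʳ y = refl

ℤ→ℚ-* : ∀ x y → ℤ→ℚ (x ℤ.* y) ≡ ℤ→ℚ x * ℤ→ℚ y
ℤ→ℚ-* x y = fromℚᵘ-homo-* (ℚᵘ.mkℚᵘ x 0) (ℚᵘ.mkℚᵘ y 0)

ℤ→ℚ-neg : ∀ x → ℤ→ℚ (ℤ.- x) ≡ - ℤ→ℚ x
ℤ→ℚ-neg x = toℚᵘ-injective (ℚᵘP.≃-trans (toℚᵘ-fromℚᵘ (ℚᵘ.mkℚᵘ (ℤ.- x) 0))
  (ℚᵘP.≃-sym (ℚᵘP.≃-trans (toℚᵘ-homo‿- (ℤ→ℚ x)) (ℚᵘP.-‿cong (toℚᵘ-fromℚᵘ (ℚᵘ.mkℚᵘ x 0))))))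

ℤ→ℚ-mono : ∀ {x y} → x ℤ.≤ y → ℤ→ℚ x ≤ ℤ→ℚ y
ℤ→ℚ-mono {x} {y} x≤y = toℚᵘ-cancel-≤
  (ℚᵘP.≤-respˡ-≃ (ℚᵘP.≃-sym (toℚᵘ-fromℚᵘ (ℚᵘ.mkℚᵘ x 0)))
  (ℚᵘP.≤-respʳ-≃ (ℚᵘP.≃-sym (toℚᵘ-fromℚᵘ (ℚᵘ.mkℚᵘ y 0)))
  (ℚᵘ.*≤* (ℤP.*-monoʳ-≤-nonNeg (+ 1) x≤y))))

ℤ→ℚ-abs : ∀ x → ∣ ℤ→ℚ x ∣ ≡ ℤ→ℚ (+ ℤ.∣ x ∣)
ℤ→ℚ-abs x = toℚᵘ-injective (ℚᵘP.≃-trans (toℚᵘ-homo-∣-∣ (ℤ→ℚ x))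
  (ℚᵘP.≃-trans (ℚᵘP.∣-∣-cong (toℚᵘ-fromℚᵘ (ℚᵘ.mkℚᵘ x 0)))
  (ℚᵘP.≃-sym (toℚᵘ-fromℚᵘ (ℚᵘ.mkℚᵘ (+ ℤ.∣ x ∣) 0)))))

ℕ→ℚ-nonNeg : ∀ m → 0ℚ ≤ ℤ→ℚ (+ m)
ℕ→ℚ-nonNeg m = ℤ→ℚ-mono {+ 0} {+ m} (ℤ.+≤+ ℕ.z≤n)

nonzero⇒1≤∣∣ : ∀ z → z ≢ + 0 → 1ℚ ≤ ∣ ℤ→ℚ z ∣
nonzero⇒1≤∣∣ z z≢0 rewrite ℤ→ℚ-abs z = ℤ→ℚ-mono (ℤ.+≤+ (1≤∣z∣ ℤ.∣ z ∣ refl))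
  where
  1≤∣z∣ : ∀ m → ℤ.∣ z ∣ ≡ m → 1 ℕ.≤ m
  1≤∣z∣ zero    eq = ⊥-elim (z≢0 (ℤP.∣i∣≡0⇒i≡0 eq))
  1≤∣z∣ (suc _) _  = ℕ.s≤s ℕ.z≤n

/-as-* : ∀ x d .{{_ : NonZero d}} → x / d ≡ ℤ→ℚ x * (+ 1 / d)
/-as-* x zero {{d≢0}} = ⊥-elim-irr (ℕ.NonZero.nonZero d≢0)
/-as-* x (suc d) = trans (fromℚᵘ-cong {ℚᵘ.mkℚᵘ x d} {ℚᵘ.mkℚᵘ x 0 ℚᵘ.* ℚᵘ.mkℚᵘ (+ 1) d} (ℚᵘ.*≡* same)) (fromℚᵘ-homo-* (ℚᵘ.mkℚᵘ x 0) (ℚᵘ.mkℚᵘ (+ 1) d))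
  where
  same : x ℤ.* + suc (d ℕ.+ 0) ≡ (x ℤ.* + 1) ℤ.* + suc d
  same rewrite ℤP.*-identityʳ x | ℕP.+-identityʳ d = refl

*-recip : ∀ d .{{_ : NonZero d}} → ℤ→ℚ (+ d) * (+ 1 / d) ≡ 1ℚ
*-recip zero {{d≢0}} = ⊥-elim-irr (ℕ.NonZero.nonZero d≢0)
*-recip (suc d) = trans (sym (/-as-* (+ suc d) (suc d)))
  (fromℚᵘ-cong {ℚᵘ.mkℚᵘ (+ suc d) d} {ℚᵘ.mkℚᵘ (+ 1) 0} (ℚᵘ.*≡* (trans (ℤP.*-identityʳ (+ suc d)) (sym (ℤP.*-identityˡ (+ suc d))))))

recip-* : ∀ d e .{{_ : NonZero d}} .{{_ : NonZero e}} →
          (+ 1 / (d ℕ.* e)) {{ℕP.m*n≢0 d e}} ≡ (+ 1 / d) * (+ 1 / e)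
recip-* zero e {{d≢0}} = ⊥-elim-irr (ℕ.NonZero.nonZero d≢0)
recip-* (suc d) zero {{_}} {{e≢0}} = ⊥-elim-irr (ℕ.NonZero.nonZero e≢0)
recip-* (suc d) (suc e) = fromℚᵘ-homo-* (ℚᵘ.mkℚᵘ (+ 1) d) (ℚᵘ.mkℚᵘ (+ 1) e)

recip-nonNeg : ∀ d .{{_ : NonZero d}} → 0ℚ ≤ + 1 / d
recip-nonNeg d = <⇒≤ (positive⁻¹ (+ 1 / d) {{normalize-pos 1 d}})

clear-denominator : ∀ d .{{_ : NonZero d}} x y → x * (+ 1 / d) ≤ y → x ≤ y * ℤ→ℚ (+ d)
clear-denominator d x y x/d≤y = *-cancelʳ-≤-pos (+ 1 / d) {{normalize-pos 1 d}}
  (subst (x * (+ 1 / d) ≤_) (sym cancel) x/d≤y)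
  where
  cancel : y * ℤ→ℚ (+ d) * (+ 1 / d) ≡ y
  cancel = trans (*-assoc y _ _) (trans (cong (y *_) (*-recip d)) (*-identityʳ y))

inv2^-cancel : ∀ t → ℤ→ℚ (+ pow2 t) * inv2^ t ≡ 1ℚ
inv2^-cancel t = *-recip (pow2 t) {{ℕP.m^n≢0 2 t}}

inv2^-nonNeg : ∀ t → 0ℚ ≤ inv2^ t
inv2^-nonNeg t = recip-nonNeg (pow2 t) {{ℕP.m^n≢0 2 t}}

inv2^-+ : ∀ d s → inv2^ (d ℕ.+ s) ≡ inv2^ d * inv2^ s
inv2^-+ d s = trans
  (/-cong {p₁ = + 1} {{ℕP.m^n≢0 2 (d ℕ.+ s)}} {{ℕP.m*n≢0 (pow2 d) (pow2 s) {{ℕP.m^n≢0 2 d}} {{ℕP.m^n≢0 2 s}}}}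
    refl (ℕP.^-distribˡ-+-* 2 d s))
  (recip-* (pow2 d) (pow2 s) {{ℕP.m^n≢0 2 d}} {{ℕP.m^n≢0 2 s}})

inv2^-shift : ∀ d s → ℤ→ℚ (+ pow2 d) * inv2^ (d ℕ.+ s) ≡ inv2^ s
inv2^-shift d s = begin
  ℤ→ℚ (+ pow2 d) * inv2^ (d ℕ.+ s)    ≡⟨ cong (ℤ→ℚ (+ pow2 d) *_) (inv2^-+ d s) ⟩
  ℤ→ℚ (+ pow2 d) * (inv2^ d * inv2^ s) ≡⟨ sym (*-assoc (ℤ→ℚ (+ pow2 d)) (inv2^ d) (inv2^ s)) ⟩
  ℤ→ℚ (+ pow2 d) * inv2^ d * inv2^ s   ≡⟨ cong (_* inv2^ s) (inv2^-cancel d) ⟩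
  1ℚ * inv2^ s                         ≡⟨ *-identityˡ (inv2^ s) ⟩
  inv2^ s                              ∎
  where open ≡-Reasoning

-- 1/2^t = 1/2^(t+1) + 1/2^(t+1): the identity behind the geometric series bound.
inv2^-halve : ∀ t → inv2^ t ≡ inv2^ (suc t) + inv2^ (suc t)
inv2^-halve t = begin
  inv2^ t                                   ≡⟨ sym (*-identityˡ (inv2^ t)) ⟩
  (+ 1 / 2 + + 1 / 2) * inv2^ t             ≡⟨ *-distribʳ-+ (inv2^ t) (+ 1 / 2) (+ 1 / 2) ⟩
  + 1 / 2 * inv2^ t + + 1 / 2 * inv2^ t     ≡⟨ sym (cong₂ _+_ (inv2^-+ 1 t) (inv2^-+ 1 t)) ⟩
  inv2^ (suc t) + inv2^ (suc t)             ∎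
  where open ≡-Reasoning

inv2^-antitone : ∀ {t t′} → t ℕ.≤ t′ → inv2^ t′ ≤ inv2^ t
inv2^-antitone {t} t≤t′ with ℕP.m≤n⇒∃[o]m+o≡n t≤t′
... | d , refl = go d
  where
  go : ∀ d → inv2^ (t ℕ.+ d) ≤ inv2^ t
  go zero rewrite ℕP.+-identityʳ t = ≤-refl
  go (suc d) rewrite ℕP.+-suc t d = begin
    inv2^ (suc (t ℕ.+ d))                               ≡⟨ sym (+-identityʳ _) ⟩
    inv2^ (suc (t ℕ.+ d)) + 0ℚ                          ≤⟨ +-monoʳ-≤ (inv2^ (suc (t ℕ.+ d))) (inv2^-nonNeg (suc (t ℕ.+ d))) ⟩
    inv2^ (suc (t ℕ.+ d)) + inv2^ (suc (t ℕ.+ d))       ≡⟨ sym (inv2^-halve (t ℕ.+ d)) ⟩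
    inv2^ (t ℕ.+ d)                                     ≤⟨ go d ⟩
    inv2^ t                                             ∎
    where open ≤-Reasoning

module PowersAboveOne (x : ℚ) (1≤x : 1ℚ ≤ x) where

  x≥0 : 0ℚ ≤ x
  x≥0 = ≤-trans (ℕ→ℚ-nonNeg 1) 1≤x

  ^ℚ-nonNeg : ∀ m → 0ℚ ≤ x ^ℚ m
  ^ℚ-nonNeg zero    = ℕ→ℚ-nonNeg 1
  ^ℚ-nonNeg (suc m) = nonNegative⁻¹ _
    {{nonNeg*nonNeg⇒nonNeg x {{nonNegative x≥0}} (x ^ℚ m) {{nonNegative (^ℚ-nonNeg m)}}}}

  ^ℚ-mono : ∀ {m m′} → m ℕ.≤ m′ → x ^ℚ m ≤ x ^ℚ m′
  ^ℚ-mono {m} m≤m′ with ℕP.m≤n⇒∃[o]m+o≡n m≤m′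
  ... | d , refl = go d
    where
    go : ∀ d → x ^ℚ m ≤ x ^ℚ (m ℕ.+ d)
    go zero rewrite ℕP.+-identityʳ m = ≤-refl
    go (suc d) rewrite ℕP.+-suc m d = ≤-trans (go d)
      (≤-trans (≤-reflexive (sym (*-identityˡ _)))
               (*-monoʳ-≤-nonNeg (x ^ℚ (m ℕ.+ d)) {{nonNegative (^ℚ-nonNeg (m ℕ.+ d))}} 1≤x))

odd-divisor-of-2 : ∀ {d} → d ∣ 2 → ¬ (2 ∣ d) → d ≡ 1
odd-divisor-of-2 {zero} d∣2 _ with 0∣⇒≡0 d∣2
... | ()
odd-divisor-of-2 {suc zero} _ _ = refl
odd-divisor-of-2 {suc (suc zero)} _ 2∤d = ⊥-elim (2∤d ∣-refl)
odd-divisor-of-2 {suc (suc (suc _))} d∣2 _ with ∣⇒≤ d∣2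
... | ℕ.s≤s (ℕ.s≤s ())

∣pow2⇒pow2 : ∀ s d → d ∣ pow2 s → ∃ λ m → d ≡ pow2 m
∣pow2⇒pow2 zero d d∣1 = 0 , ∣1⇒≡1 d∣1
∣pow2⇒pow2 (suc s) d d∣2^s+1 with 2 ∣? d
... | yes (divides j refl) with ∣pow2⇒pow2 s j (*-cancelˡ-∣ 2 (subst (_∣ 2 ℕ.* pow2 s) (ℕP.*-comm j 2) d∣2^s+1))
...   | m , refl = suc m , ℕP.*-comm (pow2 m) 2
∣pow2⇒pow2 (suc s) d d∣2^s+1 | no 2∤d = ∣pow2⇒pow2 s d (coprime-divisor d⊥2 d∣2^s+1)
  where
  d⊥2 : Coprime d 2
  d⊥2 (c∣d , c∣2) = odd-divisor-of-2 c∣2 (λ 2∣c → 2∤d (∣-trans 2∣c c∣d))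

m<pow2 : ∀ m → m ℕ.< pow2 m
m<pow2 zero    = ℕ.s≤s ℕ.z≤n
m<pow2 (suc m) = ℕP.+-mono-≤-< (ℕP.m^n>0 2 m) (ℕP.<-≤-trans (m<pow2 m) (ℕP.m≤m+n (pow2 m) 0))

pow2-∣-pow2 : ∀ {m m′} → m ℕ.≤ m′ → pow2 m ∣ pow2 m′
pow2-∣-pow2 {m} m≤m′ with ℕP.m≤n⇒∃[o]m+o≡n m≤m′
... | d , refl = divides (pow2 d) (trans (ℕP.^-distribˡ-+-* 2 m d) (ℕP.*-comm (pow2 m) (pow2 d)))

-- Being a power of two is decidable, in the strong form needed below:
-- otherwise d divides no power of two at all.
pow2-or-∤pow2 : ∀ d → (∃ λ m → d ≡ pow2 m) ⊎ (∀ s → ¬ (d ∣ pow2 s))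
pow2-or-∤pow2 d with d ∣? pow2 d
... | yes d∣2^d = inj₁ (∣pow2⇒pow2 d d d∣2^d)
... | no d∤2^d  = inj₂ λ s d∣2^s → d∤2^d (d∣2^d (∣pow2⇒pow2 s d d∣2^s))
  where
  d∣2^d : (∃ λ m → d ≡ pow2 m) → d ∣ pow2 d
  d∣2^d (m , refl) = pow2-∣-pow2 (ℕP.<⇒≤ (m<pow2 m))

-- Two different fractions b/d ≠ a/e are at least 1/(de) apart, because
-- their difference is the nonzero integer be - ad divided by de.
separation : ∀ b a d e .{{_ : NonZero d}} .{{_ : NonZero e}} →
             b ℤ.* + e ≢ a ℤ.* + d →
             (+ 1 / d) * (+ 1 / e) ≤ ∣ ℤ→ℚ b * (+ 1 / d) - a / e ∣
separation b a d e be≢ad = begin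
  w                               ≡⟨ sym (*-identityˡ w) ⟩
  1ℚ * w                          ≤⟨ *-monoʳ-≤-nonNeg w {{nonNegative w≥0}} (nonzero⇒1≤∣∣ z z≢0) ⟩
  ∣ ℤ→ℚ z ∣ * w                   ≡⟨ cong (∣ ℤ→ℚ z ∣ *_) (sym (0≤p⇒∣p∣≡p w≥0)) ⟩
  ∣ ℤ→ℚ z ∣ * ∣ w ∣               ≡⟨ sym (∣p*q∣≡∣p∣*∣q∣ (ℤ→ℚ z) w) ⟩
  ∣ ℤ→ℚ z * w ∣                   ≡⟨ cong ∣_∣ z/de ⟩
  ∣ ℤ→ℚ b * (+ 1 / d) - a / e ∣   ∎
  where
  open ≤-Reasoning
  1/d = + 1 / d
  1/e = + 1 / e
  w = 1/d * 1/e
  z = b ℤ.* + e ℤ.- a ℤ.* + d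
  w≥0 : 0ℚ ≤ w
  w≥0 = nonNegative⁻¹ w {{nonNeg*nonNeg⇒nonNeg 1/d {{nonNegative (recip-nonNeg d)}} 1/e {{nonNegative (recip-nonNeg e)}}}}
  z≢0 : z ≢ + 0
  z≢0 z≡0 = be≢ad (ℤP.i-j≡0⇒i≡j _ _ z≡0)
  z-cast : ℤ→ℚ z ≡ ℤ→ℚ b * ℤ→ℚ (+ e) - ℤ→ℚ a * ℤ→ℚ (+ d)
  z-cast = trans (ℤ→ℚ-+ (b ℤ.* + e) (ℤ.- (a ℤ.* + d)))
    (cong₂ _+_ (ℤ→ℚ-* b (+ e)) (trans (ℤ→ℚ-neg (a ℤ.* + d)) (cong -_ (ℤ→ℚ-* a (+ d)))))
  z/de : ℤ→ℚ z * w ≡ ℤ→ℚ b * 1/d - a / e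
  z/de = begin-equality
    ℤ→ℚ z * w
      ≡⟨ cong (_* w) z-cast ⟩
    (ℤ→ℚ b * ℤ→ℚ (+ e) - ℤ→ℚ a * ℤ→ℚ (+ d)) * (1/d * 1/e)
      ≡⟨ solve 6 (λ B E A D I J → (B :* E :- A :* D) :* (I :* J) := B :* I :* (E :* J) :- A :* J :* (D :* I))
               refl (ℤ→ℚ b) (ℤ→ℚ (+ e)) (ℤ→ℚ a) (ℤ→ℚ (+ d)) 1/d 1/e ⟩
    ℤ→ℚ b * 1/d * (ℤ→ℚ (+ e) * 1/e) - ℤ→ℚ a * 1/e * (ℤ→ℚ (+ d) * 1/d)
      ≡⟨ cong₂ (λ x y → ℤ→ℚ b * 1/d * x - ℤ→ℚ a * 1/e * y) (*-recip e) (*-recip d) ⟩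
    ℤ→ℚ b * 1/d * 1ℚ - ℤ→ℚ a * 1/e * 1ℚ
      ≡⟨ cong₂ _-_ (*-identityʳ (ℤ→ℚ b * 1/d)) (trans (*-identityʳ (ℤ→ℚ a * 1/e)) (sym (/-as-* a e))) ⟩
    ℤ→ℚ b * 1/d - a / e ∎

not-dyadic : ∀ {a q} b s → Coprime ℤ.∣ a ∣ q → ¬ (q ∣ pow2 s) → b ℤ.* + q ≢ a ℤ.* + pow2 s
not-dyadic {a} {q} b s a⊥q q∤2^s bq≡a2^s =
  q∤2^s (coprime-divisor (Coprimality.sym a⊥q) (divides ℤ.∣ b ∣ ∣a∣2^s≡∣b∣q))
  where
  ∣a∣2^s≡∣b∣q : ℤ.∣ a ∣ ℕ.* pow2 s ≡ ℤ.∣ b ∣ ℕ.* q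
  ∣a∣2^s≡∣b∣q = trans (sym (ℤP.abs-* a (+ pow2 s))) (trans (cong ℤ.∣_∣ (sym bq≡a2^s)) (ℤP.abs-* b (+ q)))

dyadicSum : (m : ℕ) → (r e : Fin m → ℤ) → ℚ
dyadicSum m r e = sumℚ m (λ l → r/2^ (r l) (e l))

Increasing : (m : ℕ) → (Fin m → ℤ) → Set
Increasing m e = ∀ (j j′ : Fin m) → j Fin.< j′ → e j ℤ.< e j′

Increasing-tail : ∀ {m} {e : Fin (suc m) → ℤ} → Increasing (suc m) e → Increasing m (λ l → e (Fin.suc l))
Increasing-tail inc j j′ j<j′ = inc (Fin.suc j) (Fin.suc j′) (ℕ.s≤s j<j′)

tail-above-head : ∀ {m} {e : Fin (suc m) → ℤ} {u} → Increasing (suc m) e → e Fin.zero ≡ + u →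
                  ∀ l → + suc u ℤ.≤ e (Fin.suc l)
tail-above-head {e = e} inc e₀≡u l =
  ℤP.i<j⇒suc[i]≤j (subst (ℤ._< e (Fin.suc l)) e₀≡u (inc Fin.zero (Fin.suc l) (ℕ.s≤s ℕ.z≤n)))

all-above-head : ∀ {m} {e : Fin (suc m) → ℤ} {u} → Increasing (suc m) e → e Fin.zero ≡ + u →
                 ∀ l → + u ℤ.≤ e l
all-above-head inc e₀≡u Fin.zero    = ℤP.≤-reflexive (sym e₀≡u)
all-above-head inc e₀≡u (Fin.suc l) = ℤP.≤-trans (ℤ.+≤+ (ℕP.n≤1+n _)) (tail-above-head inc e₀≡u l)

nonNeg-exponent : ∀ {t x} → + t ℤ.≤ x → ∃ λ u → x ≡ + u × t ℕ.≤ u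
nonNeg-exponent {x = + u} (ℤ.+≤+ t≤u) = u , refl , t≤u

neg-exponent : ∀ {x} → x ℤ.< + 0 → ∃ λ p → x ≡ -[1+ p ]
neg-exponent { -[1+ p ] } _ = p , refl
neg-exponent {+ _} (ℤ.+<+ ())

r/2^-nat : ∀ r u → r/2^ r (+ u) ≡ ℤ→ℚ r * inv2^ u
r/2^-nat r u = /-as-* r (pow2 u) {{ℕP.m^n≢0 2 u}}

absorb-head : ∀ {x′ x t} S → x′ ≡ x + t → x′ + S ≡ x + (t + S)
absorb-head {x = x} {t} S x′≡x+t = trans (cong (_+ S) x′≡x+t) (+-assoc x t S)

absorb-finer : ∀ b r {s u} → s ℕ.≤ u → ∃ λ b′ → ℤ→ℚ b′ * inv2^ u ≡ ℤ→ℚ b * inv2^ s + ℤ→ℚ r * inv2^ u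
absorb-finer b r {s} s≤u with ℕP.m≤n⇒∃[o]m+o≡n s≤u
... | d , refl = b ℤ.* + pow2 d ℤ.+ r , (begin
  ℤ→ℚ (b ℤ.* + pow2 d ℤ.+ r) * I   ≡⟨ cong (_* I) (trans (ℤ→ℚ-+ (b ℤ.* + pow2 d) r) (cong (_+ ℤ→ℚ r) (ℤ→ℚ-* b (+ pow2 d)))) ⟩
  (ℤ→ℚ b * P + ℤ→ℚ r) * I          ≡⟨ solve 4 (λ B P R I → (B :* P :+ R) :* I := B :* (P :* I) :+ R :* I) refl (ℤ→ℚ b) P (ℤ→ℚ r) I ⟩
  ℤ→ℚ b * (P * I) + ℤ→ℚ r * I      ≡⟨ cong (λ x → ℤ→ℚ b * x + ℤ→ℚ r * I) P*I≡ ⟩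
  ℤ→ℚ b * inv2^ s + ℤ→ℚ r * I      ∎)
  where
  open ≡-Reasoning
  P = ℤ→ℚ (+ pow2 d)
  I = inv2^ (s ℕ.+ d)
  P*I≡ : P * I ≡ inv2^ s
  P*I≡ = subst (λ x → P * inv2^ x ≡ inv2^ s) (ℕP.+-comm d s) (inv2^-shift d s)

absorb-integer : ∀ b c s → ℤ→ℚ (b ℤ.+ c ℤ.* + pow2 s) * inv2^ s ≡ ℤ→ℚ b * inv2^ s + ℤ→ℚ c
absorb-integer b c s = begin
  ℤ→ℚ (b ℤ.+ c ℤ.* + pow2 s) * inv2^ s   ≡⟨ cong (_* inv2^ s) (trans (ℤ→ℚ-+ b (c ℤ.* + pow2 s)) (cong (λ x → ℤ→ℚ b + x) (ℤ→ℚ-* c (+ pow2 s)))) ⟩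
  (ℤ→ℚ b + ℤ→ℚ c * P) * inv2^ s          ≡⟨ solve 4 (λ B C P I → (B :+ C :* P) :* I := B :* I :+ C :* (P :* I)) refl (ℤ→ℚ b) (ℤ→ℚ c) P (inv2^ s) ⟩
  ℤ→ℚ b * inv2^ s + ℤ→ℚ c * (P * inv2^ s) ≡⟨ cong (λ x → ℤ→ℚ b * inv2^ s + ℤ→ℚ c * x) (inv2^-cancel s) ⟩
  ℤ→ℚ b * inv2^ s + ℤ→ℚ c * 1ℚ           ≡⟨ cong (λ x → ℤ→ℚ b * inv2^ s + x) (*-identityʳ (ℤ→ℚ c)) ⟩
  ℤ→ℚ b * inv2^ s + ℤ→ℚ c                ∎
  where
  open ≡-Reasoning
  P = ℤ→ℚ (+ pow2 s)

-- Tail bound: a dyadic sum with numerators bounded by Q and exponents in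
-- [t, n] is a geometric series; together with the allowed error Q/2^n it
-- stays below 2Q/2^t.

module TailBound (Q : ℚ) (Q≥0 : 0ℚ ≤ Q) (n : ℕ) where

  2Q≥0 : 0ℚ ≤ Q + Q
  2Q≥0 = +-mono-≤ Q≥0 Q≥0

  2Q-halve : ∀ u → (Q + Q) * inv2^ (suc u) ≡ Q * inv2^ u
  2Q-halve u = trans (*-distribʳ-+ (inv2^ (suc u)) Q Q)
    (trans (sym (*-distribˡ-+ Q (inv2^ (suc u)) (inv2^ (suc u)))) (cong (Q *_) (sym (inv2^-halve u))))

  term-bound : ∀ r u → ∣ ℤ→ℚ r ∣ ≤ Q → ∣ ℤ→ℚ r * inv2^ u ∣ ≤ Q * inv2^ u
  term-bound r u r≤Q = begin
    ∣ ℤ→ℚ r * inv2^ u ∣       ≡⟨ ∣p*q∣≡∣p∣*∣q∣ (ℤ→ℚ r) (inv2^ u) ⟩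
    ∣ ℤ→ℚ r ∣ * ∣ inv2^ u ∣   ≡⟨ cong (∣ ℤ→ℚ r ∣ *_) (0≤p⇒∣p∣≡p (inv2^-nonNeg u)) ⟩
    ∣ ℤ→ℚ r ∣ * inv2^ u       ≤⟨ *-monoʳ-≤-nonNeg (inv2^ u) {{nonNegative (inv2^-nonNeg u)}} r≤Q ⟩
    Q * inv2^ u               ∎
    where open ≤-Reasoning

  -- By induction on the number of terms: each term r/2^u with u ≥ t uses
  -- half of the budget 2Q/2^t and leaves 2Q/2^(u+1) for the rest.
  tail-bound : ∀ m t (r e : Fin m → ℤ) → Increasing m e → (∀ l → + t ℤ.≤ e l) →
               (∀ l → e l ℤ.≤ + n) → t ℕ.≤ suc n → (∀ l → ∣ ℤ→ℚ (r l) ∣ ≤ Q) →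
               ∣ dyadicSum m r e ∣ + Q * inv2^ n ≤ (Q + Q) * inv2^ t
  tail-bound zero t r e _ _ _ t≤n+1 _ = begin
    ∣ 0ℚ ∣ + Q * inv2^ n          ≡⟨ +-identityˡ (Q * inv2^ n) ⟩
    Q * inv2^ n                   ≡⟨ sym (2Q-halve n) ⟩
    (Q + Q) * inv2^ (suc n)       ≤⟨ *-monoˡ-≤-nonNeg (Q + Q) {{nonNegative 2Q≥0}} (inv2^-antitone t≤n+1) ⟩
    (Q + Q) * inv2^ t             ∎
    where open ≤-Reasoning
  tail-bound (suc m) t r e inc t≤e e≤n _ r≤Q with nonNeg-exponent (t≤e Fin.zero)
  ... | u , e₀≡u , t≤u = begin
    ∣ T₀ + S ∣ + Q * inv2^ n                 ≤⟨ +-monoˡ-≤ (Q * inv2^ n) (∣p+q∣≤∣p∣+∣q∣ T₀ S) ⟩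
    ∣ T₀ ∣ + ∣ S ∣ + Q * inv2^ n             ≡⟨ +-assoc ∣ T₀ ∣ ∣ S ∣ (Q * inv2^ n) ⟩
    ∣ T₀ ∣ + (∣ S ∣ + Q * inv2^ n)           ≤⟨ +-mono-≤ head-bound rest-bound ⟩
    Q * inv2^ u + (Q + Q) * inv2^ (suc u)    ≡⟨ cong (λ x → Q * inv2^ u + x) (2Q-halve u) ⟩
    Q * inv2^ u + Q * inv2^ u                ≡⟨ sym (*-distribʳ-+ (inv2^ u) Q Q) ⟩
    (Q + Q) * inv2^ u                        ≤⟨ *-monoˡ-≤-nonNeg (Q + Q) {{nonNegative 2Q≥0}} (inv2^-antitone t≤u) ⟩
    (Q + Q) * inv2^ t                        ∎
    where
    open ≤-Reasoning
    T₀ = r/2^ (r Fin.zero) (e Fin.zero)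
    S = dyadicSum m (λ l → r (Fin.suc l)) (λ l → e (Fin.suc l))
    head-bound : ∣ T₀ ∣ ≤ Q * inv2^ u
    head-bound = subst (λ x → ∣ x ∣ ≤ Q * inv2^ u)
      (sym (trans (cong (r/2^ (r Fin.zero)) e₀≡u) (r/2^-nat (r Fin.zero) u)))
      (term-bound (r Fin.zero) u (r≤Q Fin.zero))
    u≤n : u ℕ.≤ n
    u≤n = ℤP.drop‿+≤+ (subst (ℤ._≤ + n) e₀≡u (e≤n Fin.zero))
    rest-bound : ∣ S ∣ + Q * inv2^ n ≤ (Q + Q) * inv2^ (suc u)
    rest-bound = tail-bound m (suc u) (λ l → r (Fin.suc l)) (λ l → e (Fin.suc l)) (Increasing-tail inc)
      (tail-above-head inc e₀≡u) (λ l → e≤n (Fin.suc l)) (ℕ.s≤s u≤n) (λ l → r≤Q (Fin.suc l))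

module Descent (n : ℕ) (Q : ℚ) (q : ℕ) .{{_ : NonZero q}} (a : ℤ)
               (q≤Q : ℤ→ℚ (+ q) ≤ Q) (a⊥q : Coprime ℤ.∣ a ∣ q)
               (q∤2^ : ∀ s → ¬ (q ∣ pow2 s)) where

  Close : ℚ → Set
  Close x = ∣ x - a / q ∣ ≤ Q * inv2^ n

  1≤q : 1ℚ ≤ ℤ→ℚ (+ q)
  1≤q = ℤ→ℚ-mono (ℤ.+≤+ (ℕ.>-nonZero⁻¹ q))

  Q≥0 : 0ℚ ≤ Q
  Q≥0 = ≤-trans (ℕ→ℚ-nonNeg q) q≤Q

  open TailBound Q Q≥0 n

  -- The constant 4Q² bounding each ratio 2^{i_{j+1} - i_j}.
  B : ℚ
  B = ℤ→ℚ (+ 4) * (Q * Q)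

  -- Each gap step costs a factor 2Qq ≤ 2Q² ≤ B.
  2Qq≤B : (Q + Q) * ℤ→ℚ (+ q) ≤ B
  2Qq≤B = begin
    (Q + Q) * ℤ→ℚ (+ q)                 ≤⟨ *-monoˡ-≤-nonNeg (Q + Q) {{nonNegative 2Q≥0}} q≤Q ⟩
    (Q + Q) * Q                         ≡⟨ sym (+-identityʳ _) ⟩
    (Q + Q) * Q + 0ℚ                    ≤⟨ +-monoʳ-≤ ((Q + Q) * Q) (nonNegative⁻¹ _ {{nonNeg*nonNeg⇒nonNeg (Q + Q) {{nonNegative 2Q≥0}} Q {{nonNegative Q≥0}}}}) ⟩
    (Q + Q) * Q + (Q + Q) * Q           ≡⟨ solve 1 (λ x → (x :+ x) :* x :+ (x :+ x) :* x := ((con 1ℚ :+ con 1ℚ) :+ (con 1ℚ :+ con 1ℚ)) :* (x :* x)) refl Q ⟩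
    B                                   ∎
    where open ≤-Reasoning

  1≤B : 1ℚ ≤ B
  1≤B = begin
    1ℚ                      ≤⟨ ≤-trans 1≤q q≤Q ⟩
    Q                       ≡⟨ sym (+-identityʳ Q) ⟩
    Q + 0ℚ                  ≤⟨ +-monoʳ-≤ Q Q≥0 ⟩
    Q + Q                   ≡⟨ sym (*-identityʳ (Q + Q)) ⟩
    (Q + Q) * 1ℚ            ≤⟨ *-monoˡ-≤-nonNeg (Q + Q) {{nonNegative 2Q≥0}} 1≤q ⟩
    (Q + Q) * ℤ→ℚ (+ q)     ≤⟨ 2Qq≤B ⟩
    B                       ∎
    where open ≤-Reasoning

  open PowersAboveOne B 1≤B public

  separated : ∀ b s → inv2^ s * (+ 1 / q) ≤ ∣ ℤ→ℚ b * inv2^ s - a / q ∣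
  separated b s = separation b a (pow2 s) q {{ℕP.m^n≢0 2 s}} (not-dyadic {a} b s a⊥q (q∤2^ s))

  gap-step : ∀ b s u T → ∣ T ∣ + Q * inv2^ n ≤ (Q + Q) * inv2^ u →
             Close (ℤ→ℚ b * inv2^ s + T) → inv2^ s ≤ B * inv2^ u
  gap-step b s u T tail close = begin
    inv2^ s                          ≤⟨ clear-denominator q (inv2^ s) _ scaled ⟩
    (Q + Q) * inv2^ u * ℤ→ℚ (+ q)    ≡⟨ solve 3 (λ c v w → c :* v :* w := c :* w :* v) refl (Q + Q) (inv2^ u) (ℤ→ℚ (+ q)) ⟩
    (Q + Q) * ℤ→ℚ (+ q) * inv2^ u    ≤⟨ *-monoʳ-≤-nonNeg (inv2^ u) {{nonNegative (inv2^-nonNeg u)}} 2Qq≤B ⟩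
    B * inv2^ u                      ∎
    where
    open ≤-Reasoning
    D = ℤ→ℚ b * inv2^ s
    scaled : inv2^ s * (+ 1 / q) ≤ (Q + Q) * inv2^ u
    scaled = begin
      inv2^ s * (+ 1 / q)         ≤⟨ separated b s ⟩
      ∣ D - a / q ∣               ≡⟨ cong ∣_∣ (solve 3 (λ d t x → d :- x := (d :+ t :- x) :- t) refl D T (a / q)) ⟩
      ∣ D + T - a / q - T ∣       ≤⟨ ∣p-q∣≤∣p∣+∣q∣ (D + T - a / q) T ⟩
      ∣ D + T - a / q ∣ + ∣ T ∣   ≤⟨ +-monoˡ-≤ ∣ T ∣ close ⟩
      Q * inv2^ n + ∣ T ∣         ≡⟨ +-comm (Q * inv2^ n) ∣ T ∣ ⟩
      ∣ T ∣ + Q * inv2^ n         ≤⟨ tail ⟩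
      (Q + Q) * inv2^ u           ∎

  -- Descent: process the m remaining terms from left to right, the part
  -- already read being b/2^s.  Each nonnegative exponent costs one gap step,
  -- each negative one is an integer absorbed into b, so reading all m terms
  -- yields 2^(n-s) ≤ B^(m+1).
  descent : ∀ m s b (r e : Fin m → ℤ) → Increasing m e → (∀ l → e l ℤ.≤ + n) →
            (∀ l → + s ℤ.≤ e l ⊎ e l ℤ.< + 0) → (∀ l → ∣ ℤ→ℚ (r l) ∣ ≤ Q) →
            Close (ℤ→ℚ b * inv2^ s + dyadicSum m r e) → inv2^ s ≤ B ^ℚ suc m * inv2^ n
  descent zero s b r e inc e≤n _ r≤Q close = begin
    inv2^ s            ≤⟨ gap-step b s n 0ℚ (tail-bound zero n r e inc (λ ()) e≤n (ℕP.n≤1+n n) r≤Q) close ⟩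
    B * inv2^ n        ≡⟨ cong (_* inv2^ n) (sym (*-identityʳ B)) ⟩
    B ^ℚ 1 * inv2^ n   ∎
    where open ≤-Reasoning
  descent (suc m) s b r e inc e≤n split r≤Q close with split Fin.zero
  ... | inj₁ s≤e₀ with nonNeg-exponent s≤e₀
  ...   | u , e₀≡u , s≤u = begin
    inv2^ s                        ≤⟨ gap-step b s u (T₀ + S) tail close ⟩
    B * inv2^ u                    ≤⟨ *-monoˡ-≤-nonNeg B {{nonNegative x≥0}} rest ⟩
    B * (B ^ℚ suc m * inv2^ n)     ≡⟨ sym (*-assoc B (B ^ℚ suc m) (inv2^ n)) ⟩
    B ^ℚ suc (suc m) * inv2^ n     ∎
    where
    open ≤-Reasoning
    T₀ = r/2^ (r Fin.zero) (e Fin.zero)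
    S = dyadicSum m (λ l → r (Fin.suc l)) (λ l → e (Fin.suc l))
    T₀≡ : T₀ ≡ ℤ→ℚ (r Fin.zero) * inv2^ u
    T₀≡ = trans (cong (r/2^ (r Fin.zero)) e₀≡u) (r/2^-nat (r Fin.zero) u)
    u≤n : u ℕ.≤ n
    u≤n = ℤP.drop‿+≤+ (subst (ℤ._≤ + n) e₀≡u (e≤n Fin.zero))
    tail : ∣ T₀ + S ∣ + Q * inv2^ n ≤ (Q + Q) * inv2^ u
    tail = tail-bound (suc m) u r e inc (all-above-head inc e₀≡u) e≤n (ℕP.m≤n⇒m≤1+n u≤n) r≤Q
    regroup = absorb-finer b (r Fin.zero) s≤u
    rest : inv2^ u ≤ B ^ℚ suc m * inv2^ n
    rest = descent m u (proj₁ regroup) (λ l → r (Fin.suc l)) (λ l → e (Fin.suc l)) (Increasing-tail inc)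
      (λ l → e≤n (Fin.suc l)) (λ l → inj₁ (all-above-head inc e₀≡u (Fin.suc l))) (λ l → r≤Q (Fin.suc l))
      (subst Close (sym (absorb-head {x = ℤ→ℚ b * inv2^ s} {t = T₀} S (trans (proj₂ regroup) (cong (λ x → ℤ→ℚ b * inv2^ s + x) (sym T₀≡))))) close)
  descent (suc m) s b r e inc e≤n split r≤Q close | inj₂ e₀<0 with neg-exponent e₀<0
  ... | p , e₀≡p = ≤-trans rest
    (*-monoʳ-≤-nonNeg (inv2^ n) {{nonNegative (inv2^-nonNeg n)}} (^ℚ-mono (ℕP.n≤1+n (suc m))))
    where
    c = r Fin.zero ℤ.* + pow2 (suc p)
    T₀ = r/2^ (r Fin.zero) (e Fin.zero)
    S = dyadicSum m (λ l → r (Fin.suc l)) (λ l → e (Fin.suc l))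
    T₀≡ : T₀ ≡ ℤ→ℚ c
    T₀≡ = cong (r/2^ (r Fin.zero)) e₀≡p
    rest : inv2^ s ≤ B ^ℚ suc m * inv2^ n
    rest = descent m s (b ℤ.+ c ℤ.* + pow2 s) (λ l → r (Fin.suc l)) (λ l → e (Fin.suc l)) (Increasing-tail inc)
      (λ l → e≤n (Fin.suc l)) (λ l → split (Fin.suc l)) (λ l → r≤Q (Fin.suc l))
      (subst Close (sym (absorb-head {x = ℤ→ℚ b * inv2^ s} {t = T₀} S (trans (absorb-integer b c s) (cong (λ x → ℤ→ℚ b * inv2^ s + x) (sym T₀≡))))) close)

lemma4p5 : (n k : ℕ) → 1 ℕ.≤ n → 1 ℕ.≤ k → (Q : ℚ) → 0ℚ < Q →
           (i r : Fin k → ℤ) →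
           (∀ (j j′ : Fin k) → j Fin.< j′ → i j ℤ.< i j′) →
           (∀ (j : Fin k) → i j ℤ.≤ + n) →
           (∀ (j : Fin k) → ∣ ℤ→ℚ (r j) ∣ ≤ Q) →
           (q : ℕ) → .{{_ : NonZero q}} → (a : ℤ) →
           ℤ→ℚ (+ q) ≤ Q →
           Coprime ℤ.∣ a ∣ q →
           ∣ sumℚ k (λ j → r/2^ (r j) (i j)) - a / q ∣ ≤ Q * inv2^ n →
           ((ℤ→ℚ (+ 4) * (Q * Q)) ^ℚ (2 ℕ.* k)) < ℤ→ℚ (+ (pow2 n)) →
           ∃ λ m → q ≡ pow2 m
lemma4p5 n k _ 1≤k Q _ i r inc i≤n r≤Q q a q≤Q a⊥q close N>B^2k with pow2-or-∤pow2 q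
... | inj₁ q-pow2 = q-pow2
... | inj₂ q∤2^ = ⊥-elim (<-irrefl refl (begin-strict
  N                ≤⟨ N≤B^[k+1] ⟩
  B ^ℚ suc k       ≤⟨ ^ℚ-mono k+1≤2k ⟩
  B ^ℚ (2 ℕ.* k)   <⟨ N>B^2k ⟩
  N                ∎))
  where
  open Descent n Q q a q≤Q a⊥q q∤2^
  open ≤-Reasoning
  N = ℤ→ℚ (+ pow2 n)
  sign : ∀ l → + 0 ℤ.≤ i l ⊎ i l ℤ.< + 0
  sign l with + 0 ℤP.≤? i l
  ... | yes 0≤i = inj₁ 0≤i
  ... | no 0≰i  = inj₂ (ℤP.≰⇒> 0≰i)
  1≤B^[k+1]/N : 1ℚ ≤ B ^ℚ suc k * inv2^ n
  1≤B^[k+1]/N = descent k 0 (+ 0) r i inc i≤n sign r≤Q (subst Close (sym (+-identityˡ (dyadicSum k r i))) close)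
  N≤B^[k+1] : N ≤ B ^ℚ suc k
  N≤B^[k+1] = *-cancelʳ-≤-pos (inv2^ n) {{normalize-pos 1 (pow2 n) {{ℕP.m^n≢0 2 n}}}}
    (subst (_≤ B ^ℚ suc k * inv2^ n) (sym (inv2^-cancel n)) 1≤B^[k+1]/N)
  k+1≤2k : suc k ℕ.≤ 2 ℕ.* k
  k+1≤2k = subst (suc k ℕ.≤_) (cong (k ℕ.+_) (sym (ℕP.+-identityʳ k))) (ℕP.+-monoˡ-≤ k 1≤k)
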